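{- There is exactly one positive integer $m$ such that $t(m)=t(11)$, $t(m+1)=t(12)$ and $t(m+2)=t(13)$ (namely $m=11$), and there is exactly one positive integer $m$ such that $t(m)=t(17)$, $t(m+1)=t(18)$ and $t(m+2)=t(19)$ (namely $m=17$).
   Context: For each positive integer $n$, define a finite ordered (planar) rooted tree $t(n)$ recursively: $t(1)$ is the tree consisting of a single root vertex; if $n>1$ has prime factorization $n=p_1^{n_1}\cdots p_k^{n_k}$ with primes $p_1<\dots<p_k$ and exponents $n_i\ge 1$, then $t(n)$ is the ordered rooted tree whose root has exactly $k$ children, ordered from left to right, where the subtree rooted at the $i$-th child is $t(n_i)$. Trees are compared as ordered rooted trees (up to isomorphism preserving root and the left-to-right order of children). In particular $t(m)=t(11)$ iff $m$ is prime; $t(12)=((())())$ (since $12=2^2\cdot 3$), so $t(m)=t(12)$ iff $m=p^r q$ with $p<q$ primes and $r$ prime; $t(18)=(()(()))$ (since $18=2\cdot 3^2$), so $t(m)=t(18)$ iff $m=p q^r$ with $p<q$ primes and $r$ prime. -}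

module Defs where

open import Data.Nat using (ℕ; zero; suc; _%_; _/_; _≤ᵇ_)
open import Data.Bool using (if_then_else_)
open import Data.List using (List; []; _∷_; map)
open import Data.Product using (_×_; _,_)

-- Propositional equality on Tree is exactly equality of
-- ordered rooted trees (root and left-to-right order preserved).
data Tree : Set where
  node : List Tree → Tree

-- strip f p n = (e , n / p^e) where e is the exponent of p in n
-- (fuel f; f ≥ n suffices for n ≥ 1).  p = 2 + k so p is nonzero.
strip : ℕ → ℕ → ℕ → ℕ × ℕ
strip zero    k n = 0 , n
strip (suc f) k n with n % suc (suc k)
... | zero with strip f k (n / suc (suc k))
...   | e , r = suc e , r
strip (suc f) k n | suc _ = 0 , n

-- Trial division: the list of (prime , exponent) pairs of n, with
-- primes strictly increasing and exponents ≥ 1, trying candidate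
-- divisors 2+k, 3+k, ... (fuel f; f = n suffices).  A candidate that
-- divides the remaining cofactor is necessarily prime, since all
-- smaller primes have already been removed.
factorise : ℕ → ℕ → ℕ → List (ℕ × ℕ)
factorise zero    k n = []
factorise (suc f) k n =
  if n ≤ᵇ 1 then []
  else (fac (strip n k n))
  where
  fac : ℕ × ℕ → List (ℕ × ℕ)
  fac (zero  , r) = factorise f (suc k) n
  fac (suc e , r) = (suc (suc k) , suc e) ∷ factorise f (suc k) r

-- tree f n: the tree t(n) computed with recursion fuel f (f = n suffices,
-- since every exponent of n is < n).
tree : ℕ → ℕ → Tree
tree zero    n = node []
tree (suc f) n = node (map (λ { (p , e) → tree f e }) (factorise n 0 n))

-- t(1) = single vertex; for n = p₁^n₁ ⋯ p_k^n_k (p₁ < ⋯ < p_k),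
-- t(n) = root with children t(n₁), …, t(n_k) in this order.
t : ℕ → Tree
t n = tree n n

{-# OPTIONS --safe #-}

-- The tree equations say that m and m + 2 are primes and that m + 1 = p ^ r * q
-- (resp. p * q ^ r) with primes p < q and r.  For m > 5 the twin primes force
-- 2 ∣ m + 1 and 3 ∣ m + 1, so p = 2 and q = 3.  If r were odd, m + 1 would be
-- 6 * 4 ^ k (resp. 6 * 9 ^ k) ≡ ±1 (mod 5), making 5 divide m or m + 2; hence
-- r = 2 and m + 1 = 12 (resp. 18).

module Submission where

open import Defs
open import Data.Nat using (ℕ; zero; suc; 2+; _+_; _*_; _^_; _<_; _≤_; z≤n; z<s; s≤s; s≤s⁻¹; _%_; _/_)
open import Data.Nat using (NonZero; NonTrivial; nonTrivial⇒n>1; nonTrivial⇒≢1; >-nonZero; >-nonZero⁻¹)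
open import Data.Nat.Properties
open import Data.Nat.DivMod
open import Data.Nat.Divisibility
open import Data.Nat.Primality
open import Data.Nat.Tactic.RingSolver using (solve; solve-∀)
open import Data.Fin using (zero; suc)
open import Data.List using (List; []; _∷_)
open import Data.List.Properties using (∷-injective; ∷-injectiveˡ)
open import Data.Product using (Σ-syntax; ∃-syntax; _×_; _,_; proj₁; proj₂)
open import Data.Sum using (_⊎_; inj₁; inj₂; [_,_]′)
open import Function using (id)
open import Function.Bundles using (_⇔_; mk⇔)
open import Relation.Nullary using (¬_; contradiction)
open import Relation.Nullary.Decidable using (from-yes)
open import Relation.Binary.PropositionalEquality

private
  variable
    l l′ d m n r x y : ℕ
    ps : List (ℕ × ℕ)
    s s′ : Tree

expand : List (ℕ × ℕ) → ℕ
expand []             = 1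
expand ((p , e) ∷ ps) = p ^ e * expand ps

data SortedPrimePowers : ℕ → List (ℕ × ℕ) → Set where
  []   : SortedPrimePowers l []
  cons : ∀ {p e} → l ≤ p → Prime p → NonZero e → SortedPrimePowers (suc p) ps →
         SortedPrimePowers l ((p , e) ∷ ps)

SortedPrimePowers-weaken : l ≤ l′ → SortedPrimePowers l′ ps → SortedPrimePowers l ps
SortedPrimePowers-weaken l≤l′ []                         = []
SortedPrimePowers-weaken l≤l′ (cons l′≤p p-prime e≢0 ps) = cons (≤-trans l≤l′ l′≤p) p-prime e≢0 ps

strip-correct : ∀ f k n .{{_ : NonZero n}} → n ≤ f →
                n ≡ (2 + k) ^ proj₁ (strip f k n) * proj₂ (strip f k n)
                × 2 + k ∤ proj₂ (strip f k n)
strip-correct zero    k n n≤0 = contradiction n≤0 (<⇒≱ (>-nonZero⁻¹ n))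
strip-correct (suc f) k n n≤f with n % (2 + k) in n%c≡
... | suc _ =
  sym (*-identityˡ n) , λ c∣n → 0≢1+n (trans (sym (n∣m⇒m%n≡0 n (2 + k) c∣n)) n%c≡)
... | zero with strip f k (n / (2 + k)) | strip-correct f k (n / (2 + k)) {{n/c≢0}} n/c≤f
  where
  n/c≢0 : NonZero (n / (2 + k))
  n/c≢0 = >-nonZero (m≥n⇒m/n>0 (∣⇒≤ (m%n≡0⇒n∣m n (2 + k) n%c≡)))
  n/c≤f : n / (2 + k) ≤ f
  n/c≤f = s≤s⁻¹ (≤-trans (m/n<m n (2 + k) (s≤s (s≤s z≤n))) n≤f)
...   | e , r | n/c≡c^e*r , c∤r = n≡c^[1+e]*r , c∤r
  where
  open ≡-Reasoning
  c = 2 + k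
  n≡c^[1+e]*r : n ≡ c ^ suc e * r
  n≡c^[1+e]*r = begin
    n                 ≡⟨ m≡m%n+[m/n]*n n c ⟩
    n % c + n / c * c ≡⟨ cong (_+ n / c * c) n%c≡ ⟩
    n / c * c         ≡⟨ *-comm (n / c) c ⟩
    c * (n / c)       ≡⟨ cong (c *_) n/c≡c^e*r ⟩
    c * (c ^ e * r)   ≡⟨ *-assoc c (c ^ e) r ⟨
    c ^ suc e * r     ∎

factorise-correct : ∀ f k n .{{_ : NonZero n}} → (2 + k) Rough n → n < f + (2 + k) →
                    expand (factorise f k n) ≡ n × SortedPrimePowers (2 + k) (factorise f k n)
factorise-correct zero    k 1        _     _    = refl , []
factorise-correct (suc f) k 1        _     _    = refl , []
factorise-correct zero    k n@(2+ _) rough n<c  = contradiction (rough⇒≤ rough) (<⇒≱ n<c)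
factorise-correct (suc f) k n@(2+ _) rough n<fc with strip n k n | strip-correct n k n ≤-refl
... | zero , r | n≡1*r , c∤r =
  proj₁ recursion , SortedPrimePowers-weaken (n≤1+n _) (proj₂ recursion)
  where
  c∤n : 2 + k ∤ n
  c∤n = subst (2 + k ∤_) (sym (trans n≡1*r (*-identityˡ r))) c∤r
  recursion : expand (factorise f (suc k) n) ≡ n
              × SortedPrimePowers (3 + k) (factorise f (suc k) n)
  recursion = factorise-correct f (suc k) n (∤⇒rough-suc c∤n rough)
                                (subst (n <_) (sym (+-suc f (2 + k))) n<fc)
... | suc e , r | n≡c^e*r , c∤r =
  trans (cong (c ^ suc e *_) (proj₁ recursion)) (sym n≡c^e*r) , cons ≤-refl c-prime _ (proj₂ recursion)
  where
  c = 2 + k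
  c∣n : c ∣ n
  c∣n = subst (c ∣_) (sym n≡c^e*r) (∣m⇒∣m*n r (m∣m*n (c ^ e)))
  r∣n : r ∣ n
  r∣n = subst (r ∣_) (sym n≡c^e*r) (n∣m*n (c ^ suc e))
  c-prime : Prime c
  c-prime = rough∧∣⇒prime rough c∣n
  instance
    r≢0 : NonZero r
    r≢0 = m*n≢0⇒n≢0 (c ^ suc e) {{subst NonZero n≡c^e*r _}}
  recursion : expand (factorise f (suc k) r) ≡ r
              × SortedPrimePowers (suc c) (factorise f (suc k) r)
  recursion = factorise-correct f (suc k) r (∤⇒rough-suc c∤r (rough∧∣⇒rough rough r∣n))
                                (subst (r <_) (sym (+-suc f c)) (≤-<-trans (∣⇒≤ r∣n) n<fc))

factorisation : ∀ n .{{_ : NonZero n}} →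
                expand (factorise n 0 n) ≡ n × SortedPrimePowers 2 (factorise n 0 n)
factorisation n = factorise-correct n 0 n 2-rough (m<m+n n z<s)

record TwoPrimeFactorisation (n : ℕ) : Set where
  field
    p a q b       : ℕ
    p-prime       : Prime p
    q-prime       : Prime q
    p<q           : p < q
    a≢0           : NonZero a
    b≢0           : NonZero b
    n≡p^a*q^b     : n ≡ p ^ a * q ^ b

node-injective : ∀ {ts us} → node ts ≡ node us → ts ≡ us
node-injective refl = refl

tree-leaf : ∀ f n .{{_ : NonZero n}} → tree (suc f) n ≡ node [] → n ≡ 1
tree-leaf f n tn with factorise n 0 n | factorisation n
tree-leaf f n tn | []    | expand≡n , _ = sym expand≡n
tree-leaf f n () | _ ∷ _ | _

-- The exponent needs fuel: tree 0 e is a leaf for every e.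
tree-prime : ∀ f n .{{_ : NonZero n}} → tree (suc (suc f)) n ≡ node (node [] ∷ []) → Prime n
tree-prime f n tn with factorise n 0 n | factorisation n
tree-prime f n () | [] | _
tree-prime f n tn | (p , e) ∷ [] | p^e*1≡n , cons _ p-prime e≢0 [] = subst Prime p≡n p-prime
  where
  e≡1 : e ≡ 1
  e≡1 = tree-leaf f e {{e≢0}} (∷-injectiveˡ (node-injective tn))
  p≡n : p ≡ n
  p≡n = trans (sym (trans (*-identityʳ (p ^ 1)) (^-identityʳ p)))
              (subst (λ e → p ^ e * 1 ≡ n) e≡1 p^e*1≡n)
tree-prime f n () | _ ∷ _ ∷ _ | _

tree-two-children : ∀ f n .{{_ : NonZero n}} → tree (suc f) n ≡ node (s ∷ s′ ∷ []) →
  Σ[ F ∈ TwoPrimeFactorisation n ]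
    tree f (TwoPrimeFactorisation.a F) ≡ s × tree f (TwoPrimeFactorisation.b F) ≡ s′
tree-two-children f n tn with factorise n 0 n | factorisation n
tree-two-children f n () | [] | _
tree-two-children f n () | _ ∷ [] | _
tree-two-children f n tn | (p , a) ∷ (q , b) ∷ []
                         | expand≡n , cons _ p-prime a≢0 (cons p<q q-prime b≢0 []) =
  F , ∷-injectiveˡ (node-injective tn) , ∷-injectiveˡ (proj₂ (∷-injective (node-injective tn)))
  where
  F : TwoPrimeFactorisation n
  F = record { p-prime = p-prime ; q-prime = q-prime ; p<q = p<q ; a≢0 = a≢0 ; b≢0 = b≢0
             ; n≡p^a*q^b = trans (sym expand≡n) (cong (p ^ a *_) (*-identityʳ (q ^ b))) }
tree-two-children f n () | _ ∷ _ ∷ _ ∷ _ | _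

t≡t[11]⇒prime : ∀ n → t n ≡ t 11 → Prime n
t≡t[11]⇒prime 0               ()
t≡t[11]⇒prime 1               ()
t≡t[11]⇒prime n@(suc (suc f)) = tree-prime f n

t≡t[12]⇒ : ∀ n → t n ≡ t 12 →
  Σ[ F ∈ TwoPrimeFactorisation n ] Prime (TwoPrimeFactorisation.a F) × TwoPrimeFactorisation.b F ≡ 1
t≡t[12]⇒ 0 ()
t≡t[12]⇒ 1 ()
t≡t[12]⇒ 2 ()
t≡t[12]⇒ n@(suc (suc (suc f))) tn with tree-two-children (suc (suc f)) n tn
... | F , ta , tb = F , tree-prime f a {{a≢0}} ta , tree-leaf (suc f) b {{b≢0}} tb
  where open TwoPrimeFactorisation F

t≡t[18]⇒ : ∀ n → t n ≡ t 18 →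
  Σ[ F ∈ TwoPrimeFactorisation n ] TwoPrimeFactorisation.a F ≡ 1 × Prime (TwoPrimeFactorisation.b F)
t≡t[18]⇒ 0 ()
t≡t[18]⇒ 1 ()
t≡t[18]⇒ 2 ()
t≡t[18]⇒ n@(suc (suc (suc f))) tn with tree-two-children (suc (suc f)) n tn
... | F , ta , tb = F , tree-leaf (suc f) a {{a≢0}} ta , tree-prime f b {{b≢0}} tb
  where open TwoPrimeFactorisation F

prime∤ : .{{NonTrivial d}} → Prime n → d < n → d ∤ n
prime∤ (prime n-not-composite) d<n d∣n = n-not-composite (composite d<n d∣n)

prime∣prime⇒≡ : Prime d → Prime n → d ∣ n → d ≡ n
prime∣prime⇒≡ d-prime n-prime d∣n =
  [ (λ d≡1 → contradiction d≡1 (nonTrivial⇒≢1 {{prime⇒nonTrivial d-prime}})) , id ]′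
  (prime⇒irreducible n-prime d∣n)

prime∣^⇒∣ : ∀ k → Prime d → d ∣ n ^ k → d ∣ n
prime∣^⇒∣ zero    d-prime d∣1 = contradiction (∣1⇒≡1 d∣1) (nonTrivial⇒≢1 {{prime⇒nonTrivial d-prime}})
prime∣^⇒∣ {n = n} (suc k) d-prime d∣n^[1+k] =
  [ id , prime∣^⇒∣ k d-prime ]′ (euclidsLemma n (n ^ k) d-prime d∣n^[1+k])

prime∣p^a*q^b⇒≡p⊎≡q : ∀ {p q} a b → Prime d → Prime p → Prime q →
                      d ∣ p ^ a * q ^ b → d ≡ p ⊎ d ≡ q
prime∣p^a*q^b⇒≡p⊎≡q {p = p} {q} a b d-prime p-prime q-prime d∣p^a*q^b
  with euclidsLemma (p ^ a) (q ^ b) d-prime d∣p^a*q^b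
... | inj₁ d∣p^a = inj₁ (prime∣prime⇒≡ d-prime p-prime (prime∣^⇒∣ a d-prime d∣p^a))
... | inj₂ d∣q^b = inj₂ (prime∣prime⇒≡ d-prime q-prime (prime∣^⇒∣ b d-prime d∣q^b))

prime[3] : Prime 3
prime[3] = from-yes (prime? 3)

prime⇒≡2⊎odd : Prime r → r ≡ 2 ⊎ ∃[ k ] r ≡ 1 + 2 * k
prime⇒≡2⊎odd {r} r-prime with r divMod 2
... | result k zero       r≡k*2   = inj₁ (sym (prime∣prime⇒≡ prime[2] r-prime (divides k r≡k*2)))
... | result k (suc zero) r≡1+k*2 = inj₂ (k , trans r≡1+k*2 (cong suc (*-comm k 2)))

oddPrime⇒2∣suc : 2 < m → Prime m → 2 ∣ m + 1
oddPrime⇒2∣suc {m} 2<m m-prime with m divMod 2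
... | result k zero       m≡k*2 = contradiction (divides k m≡k*2) (prime∤ m-prime 2<m)
... | result k (suc zero) refl  = divides (suc k) (+-comm (1 + k * 2) 1)

twinPrimes⇒3∣middle : 3 < m → Prime m → Prime (m + 2) → 3 ∣ m + 1
twinPrimes⇒3∣middle {m} 3<m m-prime m+2-prime with m divMod 3
... | result k zero             m≡k*3 = contradiction (divides k m≡k*3) (prime∤ m-prime 3<m)
... | result k (suc zero)       refl  =
  contradiction (divides (suc k) (+-comm (1 + k * 3) 2)) (prime∤ m+2-prime (m≤n⇒m≤n+o 2 3<m))
... | result k (suc (suc zero)) refl  = divides (suc k) (+-comm (2 + k * 3) 1)

twinPrimes-middle≡2^a*3^b : 3 < m → Prime m → Prime (m + 2) →
  (F : TwoPrimeFactorisation (m + 1)) →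
  m + 1 ≡ 2 ^ TwoPrimeFactorisation.a F * 3 ^ TwoPrimeFactorisation.b F
twinPrimes-middle≡2^a*3^b {m} 3<m m-prime m+2-prime F =
  subst₂ (λ p q → m + 1 ≡ p ^ a * q ^ b) p≡2 q≡3 n≡p^a*q^b
  where
  open TwoPrimeFactorisation F
  p≡2 : p ≡ 2
  p≡2 with prime∣p^a*q^b⇒≡p⊎≡q a b prime[2] p-prime q-prime
             (subst (2 ∣_) n≡p^a*q^b (oddPrime⇒2∣suc (≤-trans (n≤1+n 3) 3<m) m-prime))
  ... | inj₁ 2≡p = sym 2≡p
  ... | inj₂ 2≡q = contradiction (nonTrivial⇒n>1 p {{prime⇒nonTrivial p-prime}})
                                  (<⇒≱ (subst (p <_) (sym 2≡q) p<q))
  q≡3 : q ≡ 3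
  q≡3 with prime∣p^a*q^b⇒≡p⊎≡q a b prime[3] p-prime q-prime
             (subst (3 ∣_) n≡p^a*q^b (twinPrimes⇒3∣middle 3<m m-prime m+2-prime))
  ... | inj₁ 3≡p = contradiction (trans 3≡p p≡2) λ ()
  ... | inj₂ 3≡q = sym 3≡q

infix 4 _≡±1[mod5]

_≡±1[mod5] : ℕ → Set
x ≡±1[mod5] = ∃[ j ] (x ≡ 1 + j * 5 ⊎ x ≡ 4 + j * 5)

*-≡±1[mod5] : x ≡±1[mod5] → y ≡±1[mod5] → x * y ≡±1[mod5]
*-≡±1[mod5] (i , inj₁ refl) (j , inj₁ refl) = i + j + i * j * 5             , inj₁ (solve (i ∷ j ∷ []))
*-≡±1[mod5] (i , inj₁ refl) (j , inj₂ refl) = i * 4 + j + i * j * 5         , inj₂ (solve (i ∷ j ∷ []))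
*-≡±1[mod5] (i , inj₂ refl) (j , inj₁ refl) = i + j * 4 + i * j * 5         , inj₂ (solve (i ∷ j ∷ []))
*-≡±1[mod5] (i , inj₂ refl) (j , inj₂ refl) = 3 + i * 4 + j * 4 + i * j * 5 , inj₁ (solve (i ∷ j ∷ []))

^-≡±1[mod5] : ∀ k → x ≡±1[mod5] → x ^ k ≡±1[mod5]
^-≡±1[mod5] zero    _  = 0 , inj₁ refl
^-≡±1[mod5] (suc k) x≡ = *-≡±1[mod5] x≡ (^-≡±1[mod5] k x≡)

twinPrimes⇒middle≢±1[mod5] : 5 < m → Prime m → Prime (m + 2) → ¬ (m + 1) ≡±1[mod5]
twinPrimes⇒middle≢±1[mod5] {m} 5<m m-prime m+2-prime (j , inj₁ m+1≡1+j*5) =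
  prime∤ m-prime 5<m (divides j (suc-injective (trans (+-comm 1 m) m+1≡1+j*5)))
twinPrimes⇒middle≢±1[mod5] {m} 5<m m-prime m+2-prime (j , inj₂ m+1≡4+j*5) =
  prime∤ m+2-prime (m≤n⇒m≤n+o 2 5<m) (divides (suc j) (trans (+-suc m 1) (cong suc m+1≡4+j*5)))

twinPrimes-middle≡2^r*3⇒≡11 : 5 < m → Prime m → Prime (m + 2) → Prime r →
                              m + 1 ≡ 2 ^ r * 3 ^ 1 → m ≡ 11
twinPrimes-middle≡2^r*3⇒≡11 {m} 5<m m-prime m+2-prime r-prime m+1≡ with prime⇒≡2⊎odd r-prime
... | inj₁ refl       = +-cancelʳ-≡ 1 m 11 m+1≡
... | inj₂ (k , refl) =
  contradiction m+1≡±1[mod5] (twinPrimes⇒middle≢±1[mod5] 5<m m-prime m+2-prime)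
  where
  open ≡-Reasoning
  m+1≡6*4^k : m + 1 ≡ 6 * 4 ^ k
  m+1≡6*4^k = begin
    m + 1                   ≡⟨ m+1≡ ⟩
    2 * 2 ^ (2 * k) * 3 ^ 1 ≡⟨ cong (λ y → 2 * y * 3 ^ 1) (^-*-assoc 2 2 k) ⟨
    2 * 4 ^ k * 3 ^ 1       ≡⟨ 2*y*3≡6*y (4 ^ k) ⟩
    6 * 4 ^ k               ∎
    where
    2*y*3≡6*y : ∀ y → 2 * y * 3 ^ 1 ≡ 6 * y
    2*y*3≡6*y = solve-∀
  m+1≡±1[mod5] : m + 1 ≡±1[mod5]
  m+1≡±1[mod5] = subst _≡±1[mod5] (sym m+1≡6*4^k)
                   (*-≡±1[mod5] (1 , inj₁ refl) (^-≡±1[mod5] k (0 , inj₂ refl)))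

twinPrimes-middle≡2*3^r⇒≡17 : 5 < m → Prime m → Prime (m + 2) → Prime r →
                              m + 1 ≡ 2 ^ 1 * 3 ^ r → m ≡ 17
twinPrimes-middle≡2*3^r⇒≡17 {m} 5<m m-prime m+2-prime r-prime m+1≡ with prime⇒≡2⊎odd r-prime
... | inj₁ refl       = +-cancelʳ-≡ 1 m 17 m+1≡
... | inj₂ (k , refl) =
  contradiction m+1≡±1[mod5] (twinPrimes⇒middle≢±1[mod5] 5<m m-prime m+2-prime)
  where
  open ≡-Reasoning
  m+1≡6*9^k : m + 1 ≡ 6 * 9 ^ k
  m+1≡6*9^k = begin
    m + 1                     ≡⟨ m+1≡ ⟩
    2 ^ 1 * (3 * 3 ^ (2 * k)) ≡⟨ cong (λ y → 2 ^ 1 * (3 * y)) (^-*-assoc 3 2 k) ⟨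
    2 ^ 1 * (3 * 9 ^ k)       ≡⟨ 2*[3*y]≡6*y (9 ^ k) ⟩
    6 * 9 ^ k                 ∎
    where
    2*[3*y]≡6*y : ∀ y → 2 ^ 1 * (3 * y) ≡ 6 * y
    2*[3*y]≡6*y = solve-∀
  m+1≡±1[mod5] : m + 1 ≡±1[mod5]
  m+1≡±1[mod5] = subst _≡±1[mod5] (sym m+1≡6*9^k)
                   (*-≡±1[mod5] (1 , inj₁ refl) (^-≡±1[mod5] k (1 , inj₂ refl)))

t-pattern[11]⇒≡11 : ∀ m → t m ≡ t 11 × t (m + 1) ≡ t 12 × t (m + 2) ≡ t 13 → m ≡ 11
t-pattern[11]⇒≡11 0 (() , _)
t-pattern[11]⇒≡11 1 (() , _)
t-pattern[11]⇒≡11 2 (_ , () , _)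
t-pattern[11]⇒≡11 3 (_ , () , _)
t-pattern[11]⇒≡11 4 (() , _)
t-pattern[11]⇒≡11 5 (_ , () , _)
t-pattern[11]⇒≡11 m@(suc (suc (suc (suc (suc (suc k)))))) (tm , tm+1 , tm+2)
  with t≡t[12]⇒ (m + 1) tm+1
... | F , a-prime , b≡1 =
  twinPrimes-middle≡2^r*3⇒≡11 (m≤m+n 6 k) m-prime m+2-prime a-prime
    (subst (λ b → m + 1 ≡ 2 ^ a * 3 ^ b) b≡1
      (twinPrimes-middle≡2^a*3^b (m≤m+n 4 (2 + k)) m-prime m+2-prime F))
  where
  open TwoPrimeFactorisation F
  m-prime : Prime m
  m-prime = t≡t[11]⇒prime m tm
  m+2-prime : Prime (m + 2)
  m+2-prime = t≡t[11]⇒prime (m + 2) tm+2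

t-pattern[17]⇒≡17 : ∀ m → t m ≡ t 17 × t (m + 1) ≡ t 18 × t (m + 2) ≡ t 19 → m ≡ 17
t-pattern[17]⇒≡17 0 (() , _)
t-pattern[17]⇒≡17 1 (() , _)
t-pattern[17]⇒≡17 2 (_ , () , _)
t-pattern[17]⇒≡17 3 (_ , () , _)
t-pattern[17]⇒≡17 4 (() , _)
t-pattern[17]⇒≡17 5 (_ , () , _)
t-pattern[17]⇒≡17 m@(suc (suc (suc (suc (suc (suc k)))))) (tm , tm+1 , tm+2)
  with t≡t[18]⇒ (m + 1) tm+1
... | F , a≡1 , b-prime =
  twinPrimes-middle≡2*3^r⇒≡17 (m≤m+n 6 k) m-prime m+2-prime b-prime
    (subst (λ a → m + 1 ≡ 2 ^ a * 3 ^ b) a≡1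
      (twinPrimes-middle≡2^a*3^b (m≤m+n 4 (2 + k)) m-prime m+2-prime F))
  where
  open TwoPrimeFactorisation F
  m-prime : Prime m
  m-prime = t≡t[11]⇒prime m tm
  m+2-prime : Prime (m + 2)
  m+2-prime = t≡t[11]⇒prime (m + 2) tm+2

mainTheorem3 : ((m : ℕ) → 0 < m →
    ((t m ≡ t 11 × t (m + 1) ≡ t 12 × t (m + 2) ≡ t 13) ⇔ m ≡ 11))
    × ((m : ℕ) → 0 < m →
    ((t m ≡ t 17 × t (m + 1) ≡ t 18 × t (m + 2) ≡ t 19) ⇔ m ≡ 17))
mainTheorem3 =
  (λ m _ → mk⇔ (t-pattern[11]⇒≡11 m) λ { refl → refl , refl , refl }) ,
  (λ m _ → mk⇔ (t-pattern[17]⇒≡17 m) λ { refl → refl , refl , refl })
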